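{- Let $n\geq 5$ and let $G$ be a nontrivial connected spanning convex subgraph of $C_n^2$. If $E(G)$ contains no frame, then $n$ is odd and $G=S_{n,\frac{n-1}{2},j}$ for some integer $j$ with $0\leq j\leq n-1$.
   Context: For $n\geq 5$, the square cycle $C_n^2$ has vertex set $\mathbb{Z}_n=\mathbb{Z}/n\mathbb{Z}$, with $v_i=i+n\mathbb{Z}$ for $i\in\mathbb{Z}$, and edge set $\{\{v_i,v_j\}: i-j\in\{1,2\}\}$. For $i\in\mathbb{Z}$ write $e_i=\{v_i,v_{i+1}\}$ (frames) and $f_i=\{v_i,v_{i+2}\}$ (windows), indices modulo $n$. A spanning subgraph has vertex set all of $\mathbb{Z}_n$. The triangles are $T_i=\{e_i,e_{i+1},f_i\}$; a subgraph $G$ is convex if for every $i$, either $|T_i\cap E(G)|\leq1$ or $T_i\subseteq E(G)$. The trivial connected spanning subgraphs are $C_n^2$ itself and, when $n$ is odd, the graph $(\mathbb{Z}_n,\{f_0,\dots,f_{n-1}\})$; "nontrivial" means not one of these. For integers $j,k$ with $0\leq k\leq\lceil\frac{n-2}{2}\rceil$, $S_{n,k,j}$ is the graph with vertex set $\mathbb{Z}_n$ and edge set $E(C_n^2)\setminus\big(\{f_j,f_{j+2k+1}\}\cup\{e_{j+1},\dots,e_{j+2k+1}\}\big)$. -}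

module Defs where

open import Data.Nat using (ℕ; zero; suc; _+_; _*_; _∸_; _≤_; _<_; NonZero)
open import Data.Nat.DivMod using (_%_; _/_; m%n<n)
open import Data.Fin using (Fin; fromℕ<)
open import Data.Bool using (Bool; true; false; if_then_else_; _∧_)
open import Data.Product using (_×_; ∃-syntax)
open import Data.Sum using (_⊎_)
open import Relation.Binary.PropositionalEquality using (_≡_)
open import Relation.Nullary using (¬_)
open import Function.Bundles using (_⇔_)

v : (n : ℕ) .{{_ : NonZero n}} → ℕ → Fin n
v n i = fromℕ< (m%n<n i n)

Graph : ℕ → Set
Graph n = Fin n → Fin n → Bool

SameEdge : ∀ {n} → Fin n → Fin n → Fin n → Fin n → Set
SameEdge u w a b = (u ≡ a × w ≡ b) ⊎ (u ≡ b × w ≡ a)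

IsFrame : (n : ℕ) .{{_ : NonZero n}} → ℕ → Fin n → Fin n → Set
IsFrame n i u w = SameEdge u w (v n i) (v n (suc i))

IsWindow : (n : ℕ) .{{_ : NonZero n}} → ℕ → Fin n → Fin n → Set
IsWindow n i u w = SameEdge u w (v n i) (v n (2 + i))

C2Edge : (n : ℕ) .{{_ : NonZero n}} → Fin n → Fin n → Set
C2Edge n u w = ∃[ i ] (IsFrame n i u w ⊎ IsWindow n i u w)

WindowEdge : (n : ℕ) .{{_ : NonZero n}} → Fin n → Fin n → Set
WindowEdge n u w = ∃[ i ] IsWindow n i u w

IsSpanningSubgraph : (n : ℕ) .{{_ : NonZero n}} → Graph n → Set
IsSpanningSubgraph n G =
  (∀ u w → G u w ≡ G w u) × (∀ u w → G u w ≡ true → C2Edge n u w)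

EdgeSetIs : ∀ {n} → Graph n → (Fin n → Fin n → Set) → Set
EdgeSetIs G P = ∀ u w → (G u w ≡ true) ⇔ P u w

data Reach {n : ℕ} (G : Graph n) : Fin n → Fin n → Set where
  here : ∀ {u} → Reach G u u
  step : ∀ {u x w} → G u x ≡ true → Reach G x w → Reach G u w

Connected : ∀ {n} → Graph n → Set
Connected G = ∀ u w → Reach G u w

frameIn : (n : ℕ) .{{_ : NonZero n}} → Graph n → ℕ → Bool
frameIn n G i = G (v n i) (v n (suc i))

windowIn : (n : ℕ) .{{_ : NonZero n}} → Graph n → ℕ → Bool
windowIn n G i = G (v n i) (v n (2 + i))

b2n : Bool → ℕ
b2n true = 1
b2n false = 0

triCount : (n : ℕ) .{{_ : NonZero n}} → Graph n → ℕ → ℕ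
triCount n G i = b2n (frameIn n G i) + b2n (frameIn n G (suc i)) + b2n (windowIn n G i)

Convex : (n : ℕ) .{{_ : NonZero n}} → Graph n → Set
Convex n G = ∀ i → triCount n G i ≤ 1 ⊎ triCount n G i ≡ 3

Odd : ℕ → Set
Odd n = n % 2 ≡ 1

Nontrivial : (n : ℕ) .{{_ : NonZero n}} → Graph n → Set
Nontrivial n G = ¬ EdgeSetIs G (C2Edge n) × ¬ (Odd n × EdgeSetIs G (WindowEdge n))

SEdge : (n : ℕ) .{{_ : NonZero n}} → ℕ → ℕ → Fin n → Fin n → Set
SEdge n k j u w =
  C2Edge n u w
  × ¬ IsWindow n j u w
  × ¬ IsWindow n (j + (2 * k + 1)) u w
  × (∀ t → 1 ≤ t → t ≤ 2 * k + 1 → ¬ IsFrame n (j + t) u w)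

{-# OPTIONS --safe #-}
-- Without frames every edge of G is a window, so G lies inside the window graph
-- x ↦ x + 2.
-- For even n a window never changes the parity of a vertex, so G is disconnected.
-- For odd n the windows form a single Hamiltonian cycle v₀ v₂ v₄ …, and two missing
-- windows would cut it into two arcs that no edge of G joins. Nontriviality rules out
-- that no window is missing, so exactly one window f_j is missing. Since 2k + 1 = n
-- for k = (n - 1)/2, f_{j+2k+1} = f_j and e_{j+1}, …, e_{j+2k+1} are all the frames,
-- so G = S_{n,k,j}.
module Submission where

open import Data.Nat
open import Data.Nat.Properties
open import Data.Nat.DivMod
open import Data.Nat.Divisibility using (_∣_; ∣-refl; m%n≡0⇒n∣m)
open import Data.Bool using (true; false)
open import Data.Bool.Properties using (¬-not) renaming (_≟_ to _≟ᵇ_)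
open import Data.Fin using (Fin; toℕ)
open import Data.Fin.Properties using (toℕ-fromℕ<; toℕ-injective; toℕ<n; any?)
open import Data.Product
open import Data.Sum using (_⊎_; inj₁; inj₂)
open import Data.Empty using (⊥-elim)
open import Function.Base using (_∘_)
open import Function.Bundles using (_⇔_; mk⇔; Equivalence)
open import Relation.Binary.Definitions using (tri<; tri≈; tri>)
open import Relation.Binary.PropositionalEquality
open import Relation.Nullary using (¬_; yes; no; contradiction)
open import Defs

open ≡-Reasoning

reach-invariant : ∀ {n} {G : Graph n} (P : Fin n → Set) →
                  (∀ {a b} → G a b ≡ true → P a → P b) →
                  ∀ {u w} → Reach G u w → P u → P w
reach-invariant P closed here       p = p
reach-invariant P closed (step e r) p = reach-invariant P closed r (closed e p)

m%2≡0⊎m%2≡1 : ∀ m → m % 2 ≡ 0 ⊎ m % 2 ≡ 1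
m%2≡0⊎m%2≡1 m with m % 2 | m%n<n m 2
... | 0           | _             = inj₁ refl
... | 1           | _             = inj₂ refl
... | suc (suc _) | s≤s (s≤s ())

odd⇒2*[[n∸1]/2]+1≡n : ∀ n → Odd n → 2 * ((n ∸ 1) / 2) + 1 ≡ n
odd⇒2*[[n∸1]/2]+1≡n n odd = begin
  2 * ((n ∸ 1) / 2) + 1  ≡⟨ cong (λ m → 2 * (m / 2) + 1) (cong (_∸ 1) n≡1+h*2) ⟩
  2 * ((h * 2) / 2) + 1  ≡⟨ cong (λ m → 2 * m + 1) (m*n/n≡m h 2) ⟩
  2 * h + 1              ≡⟨ +-comm (2 * h) 1 ⟩
  1 + 2 * h              ≡⟨ cong (1 +_) (*-comm 2 h) ⟩
  1 + h * 2              ≡⟨ n≡1+h*2 ⟨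
  n                      ∎
  where
  h : ℕ
  h = n / 2
  n≡1+h*2 : n ≡ 1 + h * 2
  n≡1+h*2 = trans (m≡m%n+[m/n]*n n 2) (cong (_+ h * 2) odd)

2*[1+k]%n≡1%n : ∀ {k n} .{{_ : NonZero n}} → 2 * k + 1 ≡ n → (2 * suc k) % n ≡ 1 % n
2*[1+k]%n≡1%n {k} {n} 2k+1≡n = begin
  (2 * suc k) % n      ≡⟨ cong (_% n) (*-suc 2 k) ⟩
  (2 + 2 * k) % n      ≡⟨ cong (_% n) (+-comm 2 (2 * k)) ⟩
  (2 * k + 2) % n      ≡⟨ cong (_% n) (+-assoc (2 * k) 1 1) ⟨
  (2 * k + 1 + 1) % n  ≡⟨ cong (λ m → (m + 1) % n) 2k+1≡n ⟩
  (n + 1) % n          ≡⟨ cong (_% n) (+-comm n 1) ⟩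
  (1 + n) % n          ≡⟨ [m+n]%n≡m%n 1 n ⟩
  1 % n                ∎

m<n⇒m≤n∸1 : ∀ {m n} → m < n → m ≤ n ∸ 1
m<n⇒m≤n∸1 (s≤s m≤n) = m≤n

offset-in-[1,n] : ∀ n .{{_ : NonZero n}} {r j} → r < n → j < n →
                  ∃[ t ] (1 ≤ t × t ≤ n × (j + t) % n ≡ r)
offset-in-[1,n] n {r} {j} r<n j<n with j <? r
... | yes j<r = r ∸ j , m<n⇒0<n∸m j<r , ≤-trans (m∸n≤m r j) (<⇒≤ r<n) , (begin
  (j + (r ∸ j)) % n  ≡⟨ cong (_% n) (m+[n∸m]≡n (<⇒≤ j<r)) ⟩
  r % n              ≡⟨ m<n⇒m%n≡m r<n ⟩
  r                  ∎)
... | no j≮r = r + n ∸ j , m<n⇒0<n∸m j<r+n , r+n∸j≤n , (begin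
  (j + (r + n ∸ j)) % n  ≡⟨ cong (_% n) (m+[n∸m]≡n (<⇒≤ j<r+n)) ⟩
  (r + n) % n            ≡⟨ [m+n]%n≡m%n r n ⟩
  r % n                  ≡⟨ m<n⇒m%n≡m r<n ⟩
  r                      ∎)
  where
  j<r+n : j < r + n
  j<r+n = <-≤-trans j<n (m≤n+m n r)
  r+n∸j≤n : r + n ∸ j ≤ n
  r+n∸j≤n = ≤-trans (∸-monoʳ-≤ (r + n) (≮⇒≥ j≮r))
                    (≤-reflexive (m+n∸m≡n r n))

Between : ℕ → ℕ → ℕ → Set
Between a b p = a < p × p ≤ b

between-suc-% : ∀ {n a b p} .{{_ : NonZero n}} → b < n → p < n → p ≢ a → p ≢ b →
                Between a b p ⇔ Between a b (suc p % n)
between-suc-% {n} {a} {b} {p} b<n p<n p≢a p≢b with suc p <? n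
... | yes 1+p<n rewrite m<n⇒m%n≡m 1+p<n = mk⇔
  (λ (a<p , p≤b) → m<n⇒m<1+n a<p , ≤∧≢⇒< p≤b p≢b)
  (λ (a<1+p , 1+p≤b) → ≤∧≢⇒< (≤-pred a<1+p) (≢-sym p≢a) , <⇒≤ 1+p≤b)
... | no 1+p≮n = mk⇔
  (λ (_ , p≤b) → contradiction (≤-antisym p≤b (≤-pred (<-≤-trans b<n n≤1+p))) p≢b)
  (λ (a<1+p%n , _) → contradiction (subst (a <_) 1+p%n≡0 a<1+p%n) n≮0)
  where
  n≤1+p : n ≤ suc p
  n≤1+p = ≮⇒≥ 1+p≮n
  1+p%n≡0 : suc p % n ≡ 0
  1+p%n≡0 = trans (%-congˡ (≤-antisym p<n n≤1+p)) (n%n≡0 n)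

module Windows (n : ℕ) .{{_ : NonZero n}} where

  toℕ-v : ∀ i → toℕ (v n i) ≡ i % n
  toℕ-v i = toℕ-fromℕ< (m%n<n i n)

  toℕ-v-% : ∀ i → toℕ (v n i) % n ≡ i % n
  toℕ-v-% i = trans (cong (_% n) (toℕ-v i)) (m%n%n≡m%n i n)

  v-cong : ∀ {i j} → i % n ≡ j % n → v n i ≡ v n j
  v-cong {i} {j} eq = toℕ-injective (trans (toℕ-v i) (trans eq (sym (toℕ-v j))))

  v-toℕ : ∀ x → v n (toℕ x) ≡ x
  v-toℕ x = toℕ-injective (trans (toℕ-v _) (m<n⇒m%n≡m (toℕ<n x)))

  +-%-congʳ : ∀ a {i j} → i % n ≡ j % n → (a + i) % n ≡ (a + j) % n
  +-%-congʳ a {i} {j} eq = begin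
    (a + i) % n          ≡⟨ %-distribˡ-+ a i n ⟩
    (a % n + i % n) % n  ≡⟨ cong (λ m → (a % n + m) % n) eq ⟩
    (a % n + j % n) % n  ≡⟨ %-distribˡ-+ a j n ⟨
    (a + j) % n          ∎

  +-%-congˡ : ∀ a {i j} → i % n ≡ j % n → (i + a) % n ≡ (j + a) % n
  +-%-congˡ a {i} {j} eq = begin
    (i + a) % n  ≡⟨ cong (_% n) (+-comm i a) ⟩
    (a + i) % n  ≡⟨ +-%-congʳ a eq ⟩
    (a + j) % n  ≡⟨ cong (_% n) (+-comm a j) ⟩
    (j + a) % n  ∎

  *-%-congˡ : ∀ a {i j} → i % n ≡ j % n → (i * a) % n ≡ (j * a) % n
  *-%-congˡ a {i} {j} eq = begin
    (i * a) % n              ≡⟨ %-distribˡ-* i a n ⟩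
    ((i % n) * (a % n)) % n  ≡⟨ cong (λ m → (m * (a % n)) % n) eq ⟩
    ((j % n) * (a % n)) % n  ≡⟨ %-distribˡ-* j a n ⟨
    (j * a) % n              ∎

  next : Fin n → Fin n
  next x = v n (2 + toℕ x)

  next-v : ∀ i → next (v n i) ≡ v n (2 + i)
  next-v i = v-cong (+-%-congʳ 2 (toℕ-v-% i))

  Window : Fin n → Fin n → Fin n → Set
  Window x u w = SameEdge u w x (next x)

  IsWindow⇒Window : ∀ {i u w} → IsWindow n i u w → Window (v n i) u w
  IsWindow⇒Window {i} = subst₂ (SameEdge _ _) refl (sym (next-v i))

  Window⇒IsWindow : ∀ {x u w} → Window x u w → IsWindow n (toℕ x) u w
  Window⇒IsWindow {x} = subst₂ (SameEdge _ _) (sym (v-toℕ x)) refl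

  IsWindow-cong : ∀ {i j u w} → i % n ≡ j % n → IsWindow n i u w → IsWindow n j u w
  IsWindow-cong eq = subst₂ (SameEdge _ _) (v-cong eq) (v-cong (+-%-congʳ 2 eq))

  IsFrame-cong : ∀ {i j u w} → i % n ≡ j % n → IsFrame n i u w → IsFrame n j u w
  IsFrame-cong eq = subst₂ (SameEdge _ _) (v-cong eq) (v-cong (+-%-congʳ 1 eq))

  toℕ-v-%2 : 2 ∣ n → ∀ i → toℕ (v n i) % 2 ≡ i % 2
  toℕ-v-%2 2∣n i = trans (cong (_% 2) (toℕ-v i)) (m∣n⇒o%n%m≡o%m 2 n i 2∣n)

  toℕ-next-%2 : 2 ∣ n → ∀ x → toℕ (next x) % 2 ≡ toℕ x % 2
  toℕ-next-%2 2∣n x =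
    trans (toℕ-v-%2 2∣n (2 + toℕ x)) (%-remove-+ˡ (toℕ x) (∣-refl {2}))

  -- For c = 2⁻¹ mod n, pos z counts the window steps from v₀ to z.
  module Position (c : ℕ) (2c≡1 : (2 * c) % n ≡ 1 % n) where

    pos : Fin n → ℕ
    pos z = (toℕ z * c) % n

    pos<n : ∀ z → pos z < n
    pos<n z = m%n<n (toℕ z * c) n

    pos-next : ∀ z → pos (next z) ≡ suc (pos z) % n
    pos-next z = begin
      (toℕ (next z) * c) % n               ≡⟨ *-%-congˡ c (toℕ-v-% (2 + toℕ z)) ⟩
      ((2 + toℕ z) * c) % n                ≡⟨ cong (_% n) (*-distribʳ-+ c 2 (toℕ z)) ⟩
      (2 * c + toℕ z * c) % n              ≡⟨ +-%-congˡ (toℕ z * c) 2c≡1 ⟩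
      (1 + toℕ z * c) % n                  ≡⟨ +-%-congʳ 1 (m%n%n≡m%n (toℕ z * c) n) ⟨
      (1 + (toℕ z * c) % n) % n            ∎

    [a*c*2]%n≡a%n : ∀ a → (a * c * 2) % n ≡ a % n
    [a*c*2]%n≡a%n a = begin
      (a * c * 2) % n                  ≡⟨ cong (_% n) (*-assoc a c 2) ⟩
      (a * (c * 2)) % n                ≡⟨ cong (λ m → (a * m) % n) (*-comm c 2) ⟩
      (a * (2 * c)) % n                ≡⟨ %-distribˡ-* a (2 * c) n ⟩
      ((a % n) * ((2 * c) % n)) % n    ≡⟨ cong (λ m → ((a % n) * m) % n) 2c≡1 ⟩
      ((a % n) * (1 % n)) % n          ≡⟨ %-distribˡ-* a 1 n ⟨
      (a * 1) % n                      ≡⟨ cong (_% n) (*-identityʳ a) ⟩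
      a % n                            ∎

    pos-injective : ∀ {x y} → pos x ≡ pos y → x ≡ y
    pos-injective {x} {y} eq = toℕ-injective (begin
      toℕ x                  ≡⟨ m<n⇒m%n≡m (toℕ<n x) ⟨
      toℕ x % n              ≡⟨ [a*c*2]%n≡a%n (toℕ x) ⟨
      (toℕ x * c * 2) % n    ≡⟨ *-%-congˡ 2 eq ⟩
      (toℕ y * c * 2) % n    ≡⟨ [a*c*2]%n≡a%n (toℕ y) ⟩
      toℕ y % n              ≡⟨ m<n⇒m%n≡m (toℕ<n y) ⟩
      toℕ y                  ∎)

  module WindowGraph (G : Graph n) (sym-G : ∀ u w → G u w ≡ G w u)
                     (sub : ∀ u w → G u w ≡ true → C2Edge n u w)
                     (no-frame : ∀ i → frameIn n G i ≡ false) where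

    Gap : Fin n → Set
    Gap x = G x (next x) ≡ false

    frame-absent : ∀ {i u w} → IsFrame n i u w → G u w ≡ false
    frame-absent {i} (inj₁ (refl , refl)) = no-frame i
    frame-absent {i} (inj₂ (refl , refl)) = trans (sym-G _ _) (no-frame i)

    window-value : ∀ {x u w} → Window x u w → G u w ≡ G x (next x)
    window-value (inj₁ (refl , refl)) = refl
    window-value (inj₂ (refl , refl)) = sym-G _ _

    edge⇒window : ∀ {u w} → G u w ≡ true → ∃[ x ] Window x u w
    edge⇒window {u} {w} e with sub u w e
    ... | i , inj₁ frame  = contradiction (trans (sym e) (frame-absent frame)) λ ()
    ... | i , inj₂ window = v n i , IsWindow⇒Window window

    reach-window-invariant : (P : Fin n → Set) →
                             (∀ x → G x (next x) ≡ true → P x ⇔ P (next x)) →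
                             ∀ {u w} → Reach G u w → P u → P w
    reach-window-invariant P window-step = reach-invariant P closed
      where
      closed : ∀ {a b} → G a b ≡ true → P a → P b
      closed e with edge⇒window e
      ... | x , inj₁ (refl , refl) = Equivalence.to (window-step x e)
      ... | x , inj₂ (refl , refl) = Equivalence.from (window-step x (trans (sym-G _ _) e))

    even⇒disconnected : n % 2 ≡ 0 → ¬ Connected G
    even⇒disconnected n-even conn = contradiction 1≡0 λ ()
      where
      2∣n : 2 ∣ n
      2∣n = m%n≡0⇒n∣m n 2 n-even
      Even : Fin n → Set
      Even z = toℕ z % 2 ≡ 0
      even-step : ∀ x → G x (next x) ≡ true → Even x ⇔ Even (next x)
      even-step x _ = mk⇔ (trans (toℕ-next-%2 2∣n x)) (trans (sym (toℕ-next-%2 2∣n x)))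
      1≡0 : 1 ≡ 0
      1≡0 = trans (sym (toℕ-v-%2 2∣n 1))
        (reach-window-invariant Even even-step (conn (v n 0) (v n 1)) (toℕ-v-%2 2∣n 0))

    no-gap⇒windows : (∀ x → G x (next x) ≡ true) → EdgeSetIs G (WindowEdge n)
    no-gap⇒windows full u w = mk⇔
      (λ e → let x , window = edge⇒window e in toℕ x , Window⇒IsWindow window)
      (λ (i , window) → trans (window-value (IsWindow⇒Window window)) (full (v n i)))

    gap-exists : ¬ EdgeSetIs G (WindowEdge n) → ∃[ x ] Gap x
    gap-exists not-windows with any? (λ x → G x (next x) ≟ᵇ false)
    ... | yes gap   = gap
    ... | no no-gap =
      ⊥-elim (not-windows (no-gap⇒windows (λ x → ¬-not (no-gap ∘ (x ,_)))))

    module _ (c : ℕ) (2c≡1 : (2 * c) % n ≡ 1 % n) where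
      open Position c 2c≡1

      ordered-gaps⇒disconnected : ∀ {x y} → Gap x → Gap y → pos x < pos y →
                                  ¬ Connected G
      ordered-gaps⇒disconnected {x} {y} gap-x gap-y x<y conn =
        <-irrefl refl (proj₁ (reach-window-invariant Arc arc-step (conn y x) (x<y , ≤-refl)))
        where
        Arc : Fin n → Set
        Arc z = Between (pos x) (pos y) (pos z)
        arc-step : ∀ z → G z (next z) ≡ true → Arc z ⇔ Arc (next z)
        arc-step z present =
          subst (λ p → Arc z ⇔ Between (pos x) (pos y) p) (sym (pos-next z))
                (between-suc-% (pos<n y) (pos<n z) (avoids gap-x) (avoids gap-y))
          where
          avoids : ∀ {g} → Gap g → pos z ≢ pos g
          avoids {g} gap eq with pos-injective {z} {g} eq
          ... | refl = contradiction (trans (sym present) gap) λ ()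

      gap-unique : Connected G → ∀ {x y} → Gap x → Gap y → x ≡ y
      gap-unique conn {x} {y} gap-x gap-y with <-cmp (pos x) (pos y)
      ... | tri< x<y _ _ = ⊥-elim (ordered-gaps⇒disconnected gap-x gap-y x<y conn)
      ... | tri≈ _ eq _  = pos-injective eq
      ... | tri> _ _ y<x = ⊥-elim (ordered-gaps⇒disconnected gap-y gap-x y<x conn)

    single-gap⇒S : ∀ {k x₀} → 2 * k + 1 ≡ n → Gap x₀ →
                   (∀ {y} → Gap y → y ≡ x₀) → EdgeSetIs G (SEdge n k (toℕ x₀))
    single-gap⇒S {k} {x₀} 2k+1≡n gap unique u w = mk⇔ edge⇒S S⇒edge
      where
      j : ℕ
      j = toℕ x₀
      window-j-absent : ∀ {u w} → IsWindow n j u w → G u w ≡ false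
      window-j-absent window =
        trans (window-value (IsWindow⇒Window window)) (subst Gap (sym (v-toℕ x₀)) gap)
      j+[2k+1]≡j : (j + (2 * k + 1)) % n ≡ j % n
      j+[2k+1]≡j = trans (cong (λ m → (j + m) % n) 2k+1≡n) ([m+n]%n≡m%n j n)

      edge⇒S : G u w ≡ true → SEdge n k j u w
      edge⇒S e = sub u w e , absent window-j-absent
               , absent (window-j-absent ∘ IsWindow-cong j+[2k+1]≡j)
               , λ _ _ _ → absent frame-absent
        where
        absent : ∀ {A : Set} → (A → G u w ≡ false) → ¬ A
        absent f a = contradiction (trans (sym e) (f a)) λ ()

      S⇒edge : SEdge n k j u w → G u w ≡ true
      S⇒edge ((i , inj₁ frame) , _ , _ , no-frames)
        with offset-in-[1,n] n (m%n<n i n) (toℕ<n x₀)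
      ... | t , 1≤t , t≤n , j+t≡i =
        contradiction (IsFrame-cong (sym j+t≡i) frame)
                      (no-frames t 1≤t (subst (t ≤_) (sym 2k+1≡n) t≤n))
      S⇒edge ((i , inj₂ window) , not-j , _ , _) =
        trans (window-value (IsWindow⇒Window window)) (¬-not i-no-gap)
        where
        i-no-gap : ¬ Gap (v n i)
        i-no-gap gap-i = not-j (subst (λ x → IsWindow n (toℕ x) u w) (unique gap-i)
                                  (Window⇒IsWindow (IsWindow⇒Window window)))

lemma3p2 : (n : ℕ) .{{_ : NonZero n}} → 5 ≤ n → (G : Graph n)
    → IsSpanningSubgraph n G → Connected G → Convex n G → Nontrivial n G
    → (∀ i → frameIn n G i ≡ false)
    → Odd n × (∃[ j ] (j ≤ n ∸ 1 × EdgeSetIs G (SEdge n ((n ∸ 1) / 2) j)))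
lemma3p2 n _ G (sym-G , sub) conn _ (_ , not-windows) no-frame =
  n-odd , toℕ x₀ , m<n⇒m≤n∸1 (toℕ<n x₀) , single-gap⇒S {k} 2k+1≡n gap-x₀ unique
  where
  open Windows n
  open WindowGraph G sym-G sub no-frame

  n-odd : Odd n
  n-odd with m%2≡0⊎m%2≡1 n
  ... | inj₁ n-even = ⊥-elim (even⇒disconnected n-even conn)
  ... | inj₂ n-odd  = n-odd

  k : ℕ
  k = (n ∸ 1) / 2
  2k+1≡n : 2 * k + 1 ≡ n
  2k+1≡n = odd⇒2*[[n∸1]/2]+1≡n n n-odd

  x₀ : Fin n
  x₀ = proj₁ (gap-exists (not-windows ∘ (n-odd ,_)))
  gap-x₀ : Gap x₀
  gap-x₀ = proj₂ (gap-exists (not-windows ∘ (n-odd ,_)))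

  unique : ∀ {y} → Gap y → y ≡ x₀
  unique gap-y = gap-unique (suc k) (2*[1+k]%n≡1%n 2k+1≡n) conn gap-y gap-x₀
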